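{- For every positive integer $m$, with $n = 2m+1$, the region $A_n$ can be tiled with $m^2 + m - 1$ T-tetrominos and exactly one monomino.
   Context: For an integer $n \ge 3$, identify the $n \times n$ square with the set of unit lattice squares indexed by $(i,j)$ with $0 \le i, j \le n-1$. Define $A_n$ to be this set with the four lattice squares at $(0,0)$, $(0,1)$, $(1,0)$ and $(0,n-1)$ removed; it has area $n^2 - 4$. A T-tetromino is a polyomino made of four unit squares, three in a row and a fourth attached to the middle square of that row on one side, in any rotation or reflection. A monomino is a single unit square. A tiling of a region made of unit lattice squares is a placement of tiles aligned with the unit grid such that the tiles are pairwise non-overlapping and their union is exactly the region. -}

module Defs where

open import Data.Nat using (ℕ; zero; suc; _+_; _*_; _<ᵇ_; _≡ᵇ_)
open import Data.Bool using (Bool; true; false; _∧_; _∨_; not; if_then_else_)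
open import Data.Product using (_×_; _,_)
open import Data.List using (List; []; _∷_; map; length; filterᵇ)
open import Data.Nat.ListAction using (sum)
open import Data.Fin using (Fin; zero; suc)
open import Relation.Binary.PropositionalEquality using (_≡_)

Cell : Set
Cell = ℕ × ℕ

Region : Set
Region = Cell → Bool

A : ℕ → Region
A n (i , j) =
  (i <ᵇ n) ∧ (j <ᵇ n) ∧
  not ((i ≡ᵇ 0) ∧ (j ≡ᵇ 0)) ∧
  not ((i ≡ᵇ 0) ∧ (j ≡ᵇ 1)) ∧
  not ((i ≡ᵇ 1) ∧ (j ≡ᵇ 0)) ∧
  not ((i ≡ᵇ 0) ∧ (suc j ≡ᵇ n))

-- A placed tile: a T-tetromino in one of its 4 orientations (these are all
-- rotations/reflections of the T shape), translated by (a , b), or a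
-- monomino at (a , b).  Since every region considered lies in ℕ × ℕ, translations
-- by natural numbers (of the shapes normalised to have minimal coordinates 0)
-- cover every grid-aligned placement that could occur inside the region.
data Tile : Set where
  tetT : Fin 4 → ℕ → ℕ → Tile
  mono : ℕ → ℕ → Tile

tShape : Fin 4 → List Cell
tShape zero                   = (0 , 0) ∷ (1 , 0) ∷ (2 , 0) ∷ (1 , 1) ∷ []
tShape (suc zero)             = (0 , 1) ∷ (1 , 1) ∷ (2 , 1) ∷ (1 , 0) ∷ []
tShape (suc (suc zero))       = (0 , 0) ∷ (0 , 1) ∷ (0 , 2) ∷ (1 , 1) ∷ []
tShape (suc (suc (suc zero))) = (1 , 0) ∷ (1 , 1) ∷ (1 , 2) ∷ (0 , 1) ∷ []

shift : ℕ → ℕ → Cell → Cell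
shift a b (x , y) = (a + x , b + y)

cells : Tile → List Cell
cells (tetT o a b) = map (shift a b) (tShape o)
cells (mono a b)   = (a , b) ∷ []

cellEq : Cell → Cell → Bool
cellEq (x , y) (x' , y') = (x ≡ᵇ x') ∧ (y ≡ᵇ y')

hits : Cell → Tile → ℕ
hits c t = length (filterᵇ (cellEq c) (cells t))

coverCount : List Tile → Cell → ℕ
coverCount ts c = sum (map (hits c) ts)

-- ts tiles R: every cell of R is covered by exactly one tile (so tiles are
-- pairwise non-overlapping), and no cell outside R is covered.
IsTiling : Region → List Tile → Set
IsTiling R ts = ∀ c → coverCount ts c ≡ (if R c then 1 else 0)

isT : Tile → Bool
isT (tetT _ _ _) = true
isT (mono _ _)   = false

numT : List Tile → ℕ
numT ts = length (filterᵇ isT ts)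

numMono : List Tile → ℕ
numMono ts = length (filterᵇ (λ t → not (isT t)) ts)

module Submission where

-- A_(n+4) is the translate of A_n by (2 , 2) together with a frame of width 2, and for
-- n = 4q + 3 and n = 4q + 5 this frame is tiled by T-tetrominoes alone: four slanted strips
-- of width 2, each a row of pairs of tees, and six, respectively eight, single tees near
-- the corners. Starting from tilings of A_3 and A_5 with one monomino, this tiles every
-- A_(2m+1) with exactly one monomino. The frame is described uniformly in q: every region
-- involved is a Boolean combination of comparisons of one coordinate with a constant or
-- with 4q + k, so the identity between cover counts that makes it fit only has to be
-- checked on finitely many classes of coordinates.

open import Defs
open import Data.Bool using (Bool; true; false; T; T?; _∧_; _∨_; not; if_then_else_)
open import Data.Bool.ListAction using (all)
open import Data.Bool.Properties using (∧-comm; ∧-zeroʳ; T-∧)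
open import Data.Empty using (⊥-elim)
open import Data.Fin using (Fin; zero; suc)
open import Data.List using (List; []; _∷_; _++_; map; concatMap; length; filterᵇ; applyUpTo; upTo)
open import Data.List.Membership.Propositional using (_∈_)
open import Data.List.Membership.Propositional.Properties using (∈-++⁺ˡ; ∈-++⁺ʳ; ∈-applyUpTo⁺; ∈-upTo⁺)
open import Data.List.Properties using (map-++; map-∘; map-cong; filter-++; filter-none; length-++)
open import Data.List.Relation.Unary.All as All using (All; []; _∷_; lookup)
open import Data.List.Relation.Unary.All.Properties using (all⁺)
open import Data.List.Relation.Unary.Any using (here; there)
open import Data.Nat using (ℕ; zero; suc; _+_; _*_; _∸_; _≤_; _<_; _<ᵇ_; _≤ᵇ_; _≡ᵇ_; z≤n; s≤s)
open import Data.Nat.ListAction using (sum)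
open import Data.Nat.ListAction.Properties using (sum-++)
open import Data.Nat.Properties
  using (+-assoc; +-comm; +-identityʳ; ≡ᵇ⇒≡; <ᵇ⇒<; ≤ᵇ⇒≤; <⇒<ᵇ; <⇒≢; >⇒≢; ≤⇒≯;
         ≤-trans; ≤-reflexive; <-≤-trans; m≤m+n; m≤n+m; +-monoˡ-≤; +-monoʳ-≤; m<n⇒m<1+n)
open import Data.Nat.Tactic.RingSolver using (solve-∀)
open import Data.Product using (Σ; _×_; _,_; swap)
open import Data.Sum using (_⊎_; inj₁; inj₂)
open import Data.Unit using (⊤)
open import Function using (_∘_)
open import Function.Bundles using (Equivalence)
open import Relation.Nullary using (¬_)
open import Relation.Binary.PropositionalEquality

count : {A : Set} → (A → Bool) → List A → ℕ
count P xs = length (filterᵇ P xs)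

count-singleton : ∀ {A : Set} (P : A → Bool) x → count P (x ∷ []) ≡ (if P x then 1 else 0)
count-singleton P x with P x
... | true  = refl
... | false = refl

count-map : ∀ {A B : Set} (P : B → Bool) (f : A → B) xs → count P (map f xs) ≡ count (P ∘ f) xs
count-map P f []       = refl
count-map P f (x ∷ xs) with P (f x)
... | true  = cong suc (count-map P f xs)
... | false = count-map P f xs

count-cong : ∀ {A : Set} {P Q : A → Bool} → (∀ x → P x ≡ Q x) → ∀ xs → count P xs ≡ count Q xs
count-cong P≗Q []       = refl
count-cong {Q = Q} P≗Q (x ∷ xs) rewrite P≗Q x with Q x
... | true  = cong suc (count-cong P≗Q xs)
... | false = count-cong P≗Q xs

count-none : ∀ {A : Set} {P : A → Bool} → (∀ x → P x ≡ false) → ∀ xs → count P xs ≡ 0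
count-none P≗false []       = refl
count-none P≗false (x ∷ xs) rewrite P≗false x = count-none P≗false xs

count-++ : ∀ {A : Set} (P : A → Bool) xs ys → count P (xs ++ ys) ≡ count P xs + count P ys
count-++ P xs ys = trans (cong length (filter-++ _ xs ys)) (length-++ (filterᵇ P xs))

≢⇒≡ᵇ-false : ∀ {m n} → m ≢ n → (m ≡ᵇ n) ≡ false
≢⇒≡ᵇ-false {m} {n} m≢n with m ≡ᵇ n in eq
... | true  = ⊥-elim (m≢n (≡ᵇ⇒≡ m n (subst T (sym eq) _)))
... | false = refl

<⇒<ᵇ-true : ∀ {m n} → m < n → (m <ᵇ n) ≡ true
<⇒<ᵇ-true {m} {n} m<n with m <ᵇ n | <⇒<ᵇ m<n
... | true | _ = refl

≤⇒<ᵇ-false : ∀ {m n} → n ≤ m → (m <ᵇ n) ≡ false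
≤⇒<ᵇ-false {m} {n} n≤m with m <ᵇ n in eq
... | true  = ⊥-elim (≤⇒≯ n≤m (<ᵇ⇒< m n (subst T (sym eq) _)))
... | false = refl

+-cancelˡ-≡ᵇ : ∀ m n o → (m + n ≡ᵇ m + o) ≡ (n ≡ᵇ o)
+-cancelˡ-≡ᵇ zero    n o = refl
+-cancelˡ-≡ᵇ (suc m) n o = +-cancelˡ-≡ᵇ m n o

+-cancelʳ-≡ᵇ : ∀ m n o → (n + m ≡ᵇ o + m) ≡ (n ≡ᵇ o)
+-cancelʳ-≡ᵇ m n o rewrite +-comm n m | +-comm o m = +-cancelˡ-≡ᵇ m n o

+-cancelˡ-<ᵇ : ∀ m n o → (m + n <ᵇ m + o) ≡ (n <ᵇ o)
+-cancelˡ-<ᵇ zero    n o = refl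
+-cancelˡ-<ᵇ (suc m) n o = +-cancelˡ-<ᵇ m n o

+-cancelʳ-<ᵇ : ∀ m n o → (n + m <ᵇ o + m) ≡ (n <ᵇ o)
+-cancelʳ-<ᵇ m n o rewrite +-comm n m | +-comm o m = +-cancelˡ-<ᵇ m n o

m+n≡ᵇm : ∀ m n → (m + n ≡ᵇ m) ≡ (n ≡ᵇ 0)
m+n≡ᵇm zero    n = refl
m+n≡ᵇm (suc m) n = m+n≡ᵇm m n

m+n≡ᵇ1+m : ∀ m n → (m + n ≡ᵇ suc m) ≡ (n ≡ᵇ 1)
m+n≡ᵇ1+m zero    n = refl
m+n≡ᵇ1+m (suc m) n = m+n≡ᵇ1+m m n

m+n<ᵇm : ∀ m n → (m + n <ᵇ m) ≡ false
m+n<ᵇm zero    n = refl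
m+n<ᵇm (suc m) n = m+n<ᵇm m n

m+n<ᵇ1+m : ∀ m n → (m + n <ᵇ suc m) ≡ (n <ᵇ 1)
m+n<ᵇ1+m zero    n = refl
m+n<ᵇ1+m (suc m) n = m+n<ᵇ1+m m n

m+n<ᵇ1+m+o : ∀ m n o → (m + n <ᵇ suc (m + o)) ≡ (n <ᵇ suc o)
m+n<ᵇ1+m+o zero    n o = refl
m+n<ᵇ1+m+o (suc m) n o = m+n<ᵇ1+m+o m n o

data Split (m : ℕ) : ℕ → Set where
  before : ∀ {n} → n < m → Split m n
  offset : ∀ d → Split m (m + d)

split : ∀ m n → Split m n
split zero    n       = offset n
split (suc m) zero    = before (s≤s z≤n)
split (suc m) (suc n) with split m n
... | before n<m = before (s≤s n<m)
... | offset d   = offset d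

indicator : Region → Cell → ℕ
indicator R c = if R c then 1 else 0

coverCount-++ : ∀ ts us c → coverCount (ts ++ us) c ≡ coverCount ts c + coverCount us c
coverCount-++ ts us c = trans (cong sum (map-++ (hits c) ts us)) (sum-++ (map (hits c) ts) _)

coverCount-map : ∀ c c' (f : Tile → Tile) → (∀ t → hits c (f t) ≡ hits c' t) →
  ∀ ts → coverCount (map f ts) c ≡ coverCount ts c'
coverCount-map c c' f hits-f []       = refl
coverCount-map c c' f hits-f (t ∷ ts) = cong₂ _+_ (hits-f t) (coverCount-map c c' f hits-f ts)

coverCount-map-none : ∀ c (f : Tile → Tile) → (∀ t → hits c (f t) ≡ 0) →
  ∀ ts → coverCount (map f ts) c ≡ 0
coverCount-map-none c f hits-f []       = refl
coverCount-map-none c f hits-f (t ∷ ts) = cong₂ _+_ (hits-f t) (coverCount-map-none c f hits-f ts)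

shiftTile : ℕ → ℕ → Tile → Tile
shiftTile a b (tetT o x y) = tetT o (a + x) (b + y)
shiftTile a b (mono x y)   = mono (a + x) (b + y)

cells-shiftTile : ∀ a b t → cells (shiftTile a b t) ≡ map (shift a b) (cells t)
cells-shiftTile a b (tetT o x y) =
  trans (map-cong (λ (u , v) → cong₂ _,_ (+-assoc a x u) (+-assoc b y v)) (tShape o))
        (map-∘ (tShape o))
cells-shiftTile a b (mono x y) = refl

hits-shiftTile : ∀ a b i j t → hits (a + i , b + j) (shiftTile a b t) ≡ hits (i , j) t
hits-shiftTile a b i j t = begin
  count (cellEq (a + i , b + j)) (cells (shiftTile a b t))
    ≡⟨ cong (count _) (cells-shiftTile a b t) ⟩
  count (cellEq (a + i , b + j)) (map (shift a b) (cells t))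
    ≡⟨ count-map _ (shift a b) (cells t) ⟩
  count (cellEq (a + i , b + j) ∘ shift a b) (cells t)
    ≡⟨ count-cong (λ (x , y) → cong₂ _∧_ (+-cancelˡ-≡ᵇ a i x) (+-cancelˡ-≡ᵇ b j y)) (cells t) ⟩
  hits (i , j) t ∎
  where open ≡-Reasoning

hits-shiftTile-outside : ∀ a b i j t → i < a ⊎ j < b → hits (i , j) (shiftTile a b t) ≡ 0
hits-shiftTile-outside a b i j t outside = begin
  count (cellEq (i , j)) (cells (shiftTile a b t))
    ≡⟨ cong (count _) (cells-shiftTile a b t) ⟩
  count (cellEq (i , j)) (map (shift a b) (cells t))
    ≡⟨ count-map _ (shift a b) (cells t) ⟩
  count (cellEq (i , j) ∘ shift a b) (cells t)
    ≡⟨ count-none (missed outside) (cells t) ⟩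
  0 ∎
  where
  open ≡-Reasoning
  missed : i < a ⊎ j < b → ∀ z → cellEq (i , j) (shift a b z) ≡ false
  missed (inj₁ i<a) (x , y) rewrite ≢⇒≡ᵇ-false (<⇒≢ (<-≤-trans i<a (m≤m+n a x))) = refl
  missed (inj₂ j<b) (x , y) rewrite ≢⇒≡ᵇ-false (<⇒≢ (<-≤-trans j<b (m≤m+n b y))) = ∧-zeroʳ _

coverCount-shift : ∀ a b ts i j → coverCount (map (shiftTile a b) ts) (a + i , b + j) ≡ coverCount ts (i , j)
coverCount-shift a b ts i j = coverCount-map (a + i , b + j) (i , j) (shiftTile a b) (hits-shiftTile a b i j) ts

coverCount-shift-outside : ∀ a b ts i j → i < a ⊎ j < b → coverCount (map (shiftTile a b) ts) (i , j) ≡ 0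
coverCount-shift-outside a b ts i j outside =
  coverCount-map-none (i , j) (shiftTile a b) (λ t → hits-shiftTile-outside a b i j t outside) ts

transposeShape : Fin 4 → Fin 4
transposeShape zero                   = suc (suc zero)
transposeShape (suc zero)             = suc (suc (suc zero))
transposeShape (suc (suc zero))       = zero
transposeShape (suc (suc (suc zero))) = suc zero

tShape-transpose : ∀ o → tShape (transposeShape o) ≡ map swap (tShape o)
tShape-transpose zero                   = refl
tShape-transpose (suc zero)             = refl
tShape-transpose (suc (suc zero))       = refl
tShape-transpose (suc (suc (suc zero))) = refl

transposeTile : Tile → Tile
transposeTile (tetT o a b) = tetT (transposeShape o) b a
transposeTile (mono a b)   = mono b a

cells-transposeTile : ∀ t → cells (transposeTile t) ≡ map swap (cells t)
cells-transposeTile (tetT o a b) rewrite tShape-transpose o = trans (sym (map-∘ (tShape o))) (map-∘ (tShape o))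
cells-transposeTile (mono a b)   = refl

hits-transposeTile : ∀ i j t → hits (i , j) (transposeTile t) ≡ hits (j , i) t
hits-transposeTile i j t = begin
  count (cellEq (i , j)) (cells (transposeTile t))    ≡⟨ cong (count _) (cells-transposeTile t) ⟩
  count (cellEq (i , j)) (map swap (cells t))         ≡⟨ count-map _ swap (cells t) ⟩
  count (cellEq (i , j) ∘ swap) (cells t)             ≡⟨ count-cong (λ (x , y) → ∧-comm (i ≡ᵇ y) (j ≡ᵇ x)) (cells t) ⟩
  hits (j , i) t ∎
  where open ≡-Reasoning

IsTiling-transpose : ∀ {R ts} → IsTiling R ts → IsTiling (R ∘ swap) (map transposeTile ts)
IsTiling-transpose {ts = ts} tiles (i , j) =
  trans (coverCount-map (i , j) (j , i) transposeTile (hits-transposeTile i j) ts) (tiles (j , i))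

-- Slanted strips of T-tetrominoes

slantedStrip : ℕ → ℕ → ℕ → Region
slantedStrip a b e (i , j) =
  (i ≡ᵇ a) ∧ not (j <ᵇ b) ∧ (j <ᵇ e) ∨ (i ≡ᵇ suc a) ∧ not (j <ᵇ suc b) ∧ (j <ᵇ suc e)

stripT₁ stripT₂ : Tile
stripT₁ = tetT (suc (suc zero)) 0 0
stripT₂ = tetT (suc (suc (suc zero))) 0 2

stripTiles : ℕ → List Tile
stripTiles zero    = []
stripTiles (suc p) = stripT₁ ∷ stripT₂ ∷ map (shiftTile 0 4) (stripTiles p)

stripTiles-tiles : ∀ p → IsTiling (slantedStrip 0 0 (p * 4)) (stripTiles p)
stripTiles-tiles zero    (zero , j)           = refl
stripTiles-tiles zero    (suc zero , zero)    = refl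
stripTiles-tiles zero    (suc zero , suc j)   = refl
stripTiles-tiles zero    (suc (suc i) , j)    = refl
stripTiles-tiles (suc p) (i , j) with split 4 j
... | before j<4 = trans (cong (λ n → hits (i , j) stripT₁ + (hits (i , j) stripT₂ + n))
                              (coverCount-shift-outside 0 4 (stripTiles p) i j (inj₂ j<4)))
                        (firstBlock i j j<4)
  where
  firstBlock : ∀ i j → j < 4 → hits (i , j) stripT₁ + (hits (i , j) stripT₂ + 0) ≡ indicator (slantedStrip 0 0 (suc p * 4)) (i , j)
  firstBlock zero 0 _ = refl
  firstBlock zero 1 _ = refl
  firstBlock zero 2 _ = refl
  firstBlock zero 3 _ = refl
  firstBlock zero (suc (suc (suc (suc j)))) (s≤s (s≤s (s≤s (s≤s ()))))
  firstBlock (suc zero) 0 _ = refl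
  firstBlock (suc zero) 1 _ = refl
  firstBlock (suc zero) 2 _ = refl
  firstBlock (suc zero) 3 _ = refl
  firstBlock (suc zero) (suc (suc (suc (suc j)))) (s≤s (s≤s (s≤s (s≤s ()))))
  firstBlock (suc (suc i)) j _ = refl
... | offset j = trans (cong (λ n → hits (i , 4 + j) stripT₁ + (hits (i , 4 + j) stripT₂ + n))
                            (trans (coverCount-shift 0 4 (stripTiles p) i j) (stripTiles-tiles p (i , j))))
                      (extend i j)
  where
  extend : ∀ i j → hits (i , 4 + j) stripT₁ + (hits (i , 4 + j) stripT₂ + indicator (slantedStrip 0 0 (p * 4)) (i , j))
                 ≡ indicator (slantedStrip 0 0 (suc p * 4)) (i , 4 + j)
  extend zero         j       = refl
  extend (suc zero)   zero    = refl
  extend (suc zero)   (suc j) = refl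
  extend (suc (suc i)) j      = refl

IsTiling-slantedStrip : ∀ a b {e} p → b + p * 4 ≡ e → IsTiling (slantedStrip a b e) (map (shiftTile a b) (stripTiles p))
IsTiling-slantedStrip a b p refl (i , j) with split a i | split b j
... | before i<a | _
  rewrite coverCount-shift-outside a b (stripTiles p) i j (inj₁ i<a)
        | ≢⇒≡ᵇ-false (<⇒≢ i<a) | ≢⇒≡ᵇ-false (<⇒≢ (m<n⇒m<1+n i<a)) = refl
... | offset d | before j<b
  rewrite coverCount-shift-outside a b (stripTiles p) (a + d) j (inj₂ j<b)
        | <⇒<ᵇ-true j<b | <⇒<ᵇ-true (m<n⇒m<1+n j<b)
        | ∧-zeroʳ (a + d ≡ᵇ a) | ∧-zeroʳ (a + d ≡ᵇ suc a) = refl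
... | offset d | offset k
  rewrite coverCount-shift a b (stripTiles p) d k
        | m+n≡ᵇm a d | m+n≡ᵇ1+m a d | m+n<ᵇm b k | +-cancelˡ-<ᵇ b k (p * 4)
        | m+n<ᵇ1+m b k | m+n<ᵇ1+m+o b k (p * 4) = stripTiles-tiles p (d , k)

-- Offsets from X are stored as k + X so that A (suc c + X) and its translate by (2 , 2)
-- reduce to instances of sat.
data Pos : Set where
  #_  : ℕ → Pos
  X+_ : ℕ → Pos

⟦_⟧ : Pos → ℕ → ℕ
⟦ # k  ⟧ X = k
⟦ X+ k ⟧ X = k + X

sucᵖ : Pos → Pos
sucᵖ (# k)  = # suc k
sucᵖ (X+ k) = X+ suc k

⟦sucᵖ⟧ : ∀ P X → ⟦ sucᵖ P ⟧ X ≡ suc (⟦ P ⟧ X)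
⟦sucᵖ⟧ (# k)  X = refl
⟦sucᵖ⟧ (X+ k) X = refl

_+ᵖ_ : Pos → ℕ → Pos
(# k)  +ᵖ x = # (k + x)
(X+ k) +ᵖ x = X+ (k + x)

⟦+ᵖ⟧ : ∀ P x X → ⟦ P ⟧ X + x ≡ ⟦ P +ᵖ x ⟧ X
⟦+ᵖ⟧ (# k)  x X = refl
⟦+ᵖ⟧ (X+ k) x X = begin
  k + X + x   ≡⟨ +-assoc k X x ⟩
  k + (X + x) ≡⟨ cong (k +_) (+-comm X x) ⟩
  k + (x + X) ≡⟨ sym (+-assoc k x X) ⟩
  k + x + X   ∎
  where open ≡-Reasoning

data Atom : Set where
  at below : Pos → Atom

holds : ℕ → ℕ → Atom → Bool
holds X v (at P)    = v ≡ᵇ ⟦ P ⟧ X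
holds X v (below P) = v <ᵇ ⟦ P ⟧ X

infixr 6 _∧ᶠ_
infixr 5 _∨ᶠ_
data Formula : Set where
  row col     : Atom → Formula
  _∧ᶠ_ _∨ᶠ_  : Formula → Formula → Formula
  ¬ᶠ_         : Formula → Formula

evalF : (Atom → Bool) → (Atom → Bool) → Formula → Bool
evalF ρ γ (row a)   = ρ a
evalF ρ γ (col a)   = γ a
evalF ρ γ (φ ∧ᶠ ψ)  = evalF ρ γ φ ∧ evalF ρ γ ψ
evalF ρ γ (φ ∨ᶠ ψ)  = evalF ρ γ φ ∨ evalF ρ γ ψ
evalF ρ γ (¬ᶠ φ)    = not (evalF ρ γ φ)

sat : ℕ → Cell → Formula → Bool
sat X (i , j) = evalF (holds X i) (holds X j)

transposeᶠ : Formula → Formula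
transposeᶠ (row a)  = col a
transposeᶠ (col a)  = row a
transposeᶠ (φ ∧ᶠ ψ) = transposeᶠ φ ∧ᶠ transposeᶠ ψ
transposeᶠ (φ ∨ᶠ ψ) = transposeᶠ φ ∨ᶠ transposeᶠ ψ
transposeᶠ (¬ᶠ φ)   = ¬ᶠ transposeᶠ φ

evalF-transposeᶠ : ∀ ρ γ φ → evalF ρ γ (transposeᶠ φ) ≡ evalF γ ρ φ
evalF-transposeᶠ ρ γ (row a)  = refl
evalF-transposeᶠ ρ γ (col a)  = refl
evalF-transposeᶠ ρ γ (φ ∧ᶠ ψ) = cong₂ _∧_ (evalF-transposeᶠ ρ γ φ) (evalF-transposeᶠ ρ γ ψ)
evalF-transposeᶠ ρ γ (φ ∨ᶠ ψ) = cong₂ _∨_ (evalF-transposeᶠ ρ γ φ) (evalF-transposeᶠ ρ γ ψ)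
evalF-transposeᶠ ρ γ (¬ᶠ φ)   = cong not (evalF-transposeᶠ ρ γ φ)

Describes : ℕ → List Formula → List Tile → Set
Describes X φs ts = ∀ c → coverCount ts c ≡ count (sat X c) φs

Describes-++ : ∀ {X φs ψs ts us} → Describes X φs ts → Describes X ψs us → Describes X (φs ++ ψs) (ts ++ us)
Describes-++ {X} {φs} {ψs} {ts} {us} dt du c = begin
  coverCount (ts ++ us) c                     ≡⟨ coverCount-++ ts us c ⟩
  coverCount ts c + coverCount us c           ≡⟨ cong₂ _+_ (dt c) (du c) ⟩
  count (sat X c) φs + count (sat X c) ψs     ≡⟨ count-++ (sat X c) φs ψs ⟨
  count (sat X c) (φs ++ ψs)                  ∎
  where open ≡-Reasoning

IsTiling⇒Describes : ∀ {X R} ts φ → (∀ c → R c ≡ sat X c φ) → IsTiling R ts → Describes X (φ ∷ []) ts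
IsTiling⇒Describes {X} ts φ R≗φ tiles c =
  trans (tiles c) (trans (cong (λ b → if b then 1 else 0) (R≗φ c)) (sym (count-singleton (sat X c) φ)))

-- A formula whose constants are below B and whose offsets from X are below D cannot
-- distinguish two coordinates of the same class once B ≤ X, so an identity between counts
-- holds at every cell as soon as it holds for each of the finitely many pairs of classes.
module Breakpoints (B D : ℕ) where

  wfAtom : Atom → Bool
  wfAtom (at (# k))     = k <ᵇ B
  wfAtom (below (# k))  = k ≤ᵇ B
  wfAtom (at (X+ k))    = k <ᵇ D
  wfAtom (below (X+ k)) = k ≤ᵇ D

  wf : Formula → Bool
  wf (row a)  = wfAtom a
  wf (col a)  = wfAtom a
  wf (φ ∧ᶠ ψ) = wf φ ∧ wf ψ
  wf (φ ∨ᶠ ψ) = wf φ ∧ wf ψ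
  wf (¬ᶠ φ)   = wf φ

  data Class : Set where
    small  : ℕ → Class
    middle : Class
    large  : ℕ → Class
    huge   : Class

  InClass : ℕ → ℕ → Class → Set
  InClass X v (small k) = v ≡ k × k < B
  InClass X v middle    = B ≤ v × v < X
  InClass X v (large k) = v ≡ k + X × k < D
  InClass X v huge      = D + X ≤ v

  classes : List Class
  classes = applyUpTo small B ++ middle ∷ applyUpTo large D ++ huge ∷ []

  classify : ∀ {X} → B ≤ X → ∀ v → Σ Class λ c → c ∈ classes × InClass X v c
  classify {X} B≤X v with split X v
  ... | offset d with split D d
  ...   | before d<D = large d , ∈-++⁺ʳ _ (there (∈-++⁺ˡ (∈-applyUpTo⁺ large d<D))) , +-comm X d , d<D
  ...   | offset e   = huge , ∈-++⁺ʳ _ (there (∈-++⁺ʳ _ (here refl)))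
                     , ≤-trans (≤-reflexive (+-comm D X)) (+-monoʳ-≤ X (m≤m+n D e))
  classify {X} B≤X v | before v<X with split B v
  ...   | before v<B = small v , ∈-++⁺ˡ (∈-applyUpTo⁺ small v<B) , refl , v<B
  ...   | offset d   = middle , ∈-++⁺ʳ _ (here refl) , m≤m+n B d , v<X

  holdsᶜ : Class → Atom → Bool
  holdsᶜ (small k) (at (# k'))     = k ≡ᵇ k'
  holdsᶜ (small k) (below (# k'))  = k <ᵇ k'
  holdsᶜ (small k) (at (X+ _))     = false
  holdsᶜ (small k) (below (X+ _))  = true
  holdsᶜ middle    (at _)          = false
  holdsᶜ middle    (below (# _))   = false
  holdsᶜ middle    (below (X+ _))  = true
  holdsᶜ (large k) (at (# _))      = false
  holdsᶜ (large k) (below (# _))   = false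
  holdsᶜ (large k) (at (X+ k'))    = k ≡ᵇ k'
  holdsᶜ (large k) (below (X+ k')) = k <ᵇ k'
  holdsᶜ huge      _               = false

  holds-class : ∀ {X v} c → B ≤ X → InClass X v c → ∀ a → T (wfAtom a) → holds X v a ≡ holdsᶜ c a
  holds-class (small k) B≤X (refl , k<B) (at (# k'))     _ = refl
  holds-class (small k) B≤X (refl , k<B) (below (# k'))  _ = refl
  holds-class {X} (small k) B≤X (refl , k<B) (at (X+ k')) _ =
    ≢⇒≡ᵇ-false (<⇒≢ (<-≤-trans k<B (≤-trans B≤X (m≤n+m X k'))))
  holds-class {X} (small k) B≤X (refl , k<B) (below (X+ k')) _ =
    <⇒<ᵇ-true (<-≤-trans k<B (≤-trans B≤X (m≤n+m X k')))
  holds-class middle B≤X (B≤v , v<X) (at (# k')) w = ≢⇒≡ᵇ-false (>⇒≢ (<-≤-trans (<ᵇ⇒< k' B w) B≤v))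
  holds-class middle B≤X (B≤v , v<X) (below (# k')) w = ≤⇒<ᵇ-false (≤-trans (≤ᵇ⇒≤ k' B w) B≤v)
  holds-class {X} middle B≤X (B≤v , v<X) (at (X+ k')) _ = ≢⇒≡ᵇ-false (<⇒≢ (<-≤-trans v<X (m≤n+m X k')))
  holds-class {X} middle B≤X (B≤v , v<X) (below (X+ k')) _ = <⇒<ᵇ-true (<-≤-trans v<X (m≤n+m X k'))
  holds-class {X} (large k) B≤X (refl , _) (at (# k')) w =
    ≢⇒≡ᵇ-false (>⇒≢ (<-≤-trans (<ᵇ⇒< k' B w) (≤-trans B≤X (m≤n+m X k))))
  holds-class {X} (large k) B≤X (refl , _) (below (# k')) w =
    ≤⇒<ᵇ-false (≤-trans (≤ᵇ⇒≤ k' B w) (≤-trans B≤X (m≤n+m X k)))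
  holds-class {X} (large k) B≤X (refl , _) (at (X+ k'))    _ = +-cancelʳ-≡ᵇ X k k'
  holds-class {X} (large k) B≤X (refl , _) (below (X+ k')) _ = +-cancelʳ-<ᵇ X k k'
  holds-class {X} huge B≤X D+X≤v (at (# k')) w =
    ≢⇒≡ᵇ-false (>⇒≢ (<-≤-trans (<ᵇ⇒< k' B w) (≤-trans B≤X (≤-trans (m≤n+m X D) D+X≤v))))
  holds-class {X} huge B≤X D+X≤v (below (# k')) w =
    ≤⇒<ᵇ-false (≤-trans (≤ᵇ⇒≤ k' B w) (≤-trans B≤X (≤-trans (m≤n+m X D) D+X≤v)))
  holds-class {X} huge B≤X D+X≤v (at (X+ k')) w =
    ≢⇒≡ᵇ-false (>⇒≢ (<-≤-trans (+-monoˡ-≤ X (<ᵇ⇒< k' D w)) D+X≤v))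
  holds-class {X} huge B≤X D+X≤v (below (X+ k')) w =
    ≤⇒<ᵇ-false (≤-trans (+-monoˡ-≤ X (≤ᵇ⇒≤ k' D w)) D+X≤v)

  AgreeOnWf : (Atom → Bool) → (Atom → Bool) → Set
  AgreeOnWf ρ ρ' = ∀ a → T (wfAtom a) → ρ a ≡ ρ' a

  evalF-cong : ∀ {ρ γ ρ' γ'} → AgreeOnWf ρ ρ' → AgreeOnWf γ γ' →
    ∀ φ → T (wf φ) → evalF ρ γ φ ≡ evalF ρ' γ' φ
  evalF-cong ρ≈ γ≈ (row a)  w = ρ≈ a w
  evalF-cong ρ≈ γ≈ (col a)  w = γ≈ a w
  evalF-cong ρ≈ γ≈ (φ ∧ᶠ ψ) w with wφ , wψ ← Equivalence.to T-∧ w =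
    cong₂ _∧_ (evalF-cong ρ≈ γ≈ φ wφ) (evalF-cong ρ≈ γ≈ ψ wψ)
  evalF-cong ρ≈ γ≈ (φ ∨ᶠ ψ) w with wφ , wψ ← Equivalence.to T-∧ w =
    cong₂ _∨_ (evalF-cong ρ≈ γ≈ φ wφ) (evalF-cong ρ≈ γ≈ ψ wψ)
  evalF-cong ρ≈ γ≈ (¬ᶠ φ)   w = cong not (evalF-cong ρ≈ γ≈ φ w)

  count-evalF-cong : ∀ {ρ γ ρ' γ'} → AgreeOnWf ρ ρ' → AgreeOnWf γ γ' →
    ∀ {φs} → All (T ∘ wf) φs → count (evalF ρ γ) φs ≡ count (evalF ρ' γ') φs
  count-evalF-cong ρ≈ γ≈ []                       = refl
  count-evalF-cong {ρ} {γ} {ρ'} {γ'} ρ≈ γ≈ {φ ∷ φs} (wφ ∷ wφs)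
    rewrite evalF-cong ρ≈ γ≈ φ wφ with evalF ρ' γ' φ
  ... | true  = cong suc (count-evalF-cong ρ≈ γ≈ wφs)
  ... | false = count-evalF-cong ρ≈ γ≈ wφs

  countᶜ : Class → Class → List Formula → ℕ
  countᶜ cᵢ cⱼ = count (evalF (holdsᶜ cᵢ) (holdsᶜ cⱼ))

  agree : List Formula → List Formula → Bool
  agree φs ψs = all wf φs ∧ all wf ψs
    ∧ all (λ cᵢ → all (λ cⱼ → countᶜ cᵢ cⱼ φs ≡ᵇ countᶜ cᵢ cⱼ ψs) classes) classes

  agree-sound : ∀ {X} φs ψs → B ≤ X → T (agree φs ψs) → ∀ c → count (sat X c) φs ≡ count (sat X c) ψs
  agree-sound {X} φs ψs B≤X ok (i , j)
    with wfφs , ok′ ← Equivalence.to T-∧ ok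
    with wfψs , same ← Equivalence.to T-∧ ok′
    with cᵢ , cᵢ∈ , i∈cᵢ ← classify B≤X i
    with cⱼ , cⱼ∈ , j∈cⱼ ← classify B≤X j = begin
      count (sat X (i , j)) φs  ≡⟨ count-evalF-cong ρ≈ γ≈ (all⁺ wf φs wfφs) ⟩
      countᶜ cᵢ cⱼ φs           ≡⟨ ≡ᵇ⇒≡ _ _ (lookup (all⁺ _ classes (lookup (all⁺ _ classes same) cᵢ∈)) cⱼ∈) ⟩
      countᶜ cᵢ cⱼ ψs           ≡⟨ count-evalF-cong ρ≈ γ≈ (all⁺ wf ψs wfψs) ⟨
      count (sat X (i , j)) ψs  ∎
    where
    open ≡-Reasoning
    ρ≈ : AgreeOnWf (holds X i) (holdsᶜ cᵢ)
    ρ≈ = holds-class cᵢ B≤X i∈cᵢ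
    γ≈ : AgreeOnWf (holds X j) (holdsᶜ cⱼ)
    γ≈ = holds-class cⱼ B≤X j∈cⱼ

-- The frame around a translated tiling

stripᶠ : Pos → Pos → Pos → Formula
stripᶠ Pa Pb Pe = row (at Pa) ∧ᶠ ¬ᶠ col (below Pb) ∧ᶠ col (below Pe)
               ∨ᶠ row (at (sucᵖ Pa)) ∧ᶠ ¬ᶠ col (below (sucᵖ Pb)) ∧ᶠ col (below (sucᵖ Pe))

sat-stripᶠ : ∀ X Pa Pb Pe c → slantedStrip (⟦ Pa ⟧ X) (⟦ Pb ⟧ X) (⟦ Pe ⟧ X) c ≡ sat X c (stripᶠ Pa Pb Pe)
sat-stripᶠ X Pa Pb Pe (i , j) rewrite ⟦sucᵖ⟧ Pa X | ⟦sucᵖ⟧ Pb X | ⟦sucᵖ⟧ Pe X = refl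

cellᶠ : Pos → Pos → Cell → Formula
cellᶠ Pa Pb (x , y) = row (at (Pa +ᵖ x)) ∧ᶠ col (at (Pb +ᵖ y))

tee-Describes : ∀ X o Pa Pb → Describes X (map (cellᶠ Pa Pb) (tShape o)) (tetT o (⟦ Pa ⟧ X) (⟦ Pb ⟧ X) ∷ [])
tee-Describes X o Pa Pb (i , j) = begin
  hits (i , j) (tetT o (⟦ Pa ⟧ X) (⟦ Pb ⟧ X)) + 0
    ≡⟨ +-identityʳ _ ⟩
  count (cellEq (i , j)) (map (shift (⟦ Pa ⟧ X) (⟦ Pb ⟧ X)) (tShape o))
    ≡⟨ count-map _ _ (tShape o) ⟩
  count (cellEq (i , j) ∘ shift (⟦ Pa ⟧ X) (⟦ Pb ⟧ X)) (tShape o)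
    ≡⟨ count-cong (λ (x , y) → cong₂ (λ p q → (i ≡ᵇ p) ∧ (j ≡ᵇ q)) (⟦+ᵖ⟧ Pa x X) (⟦+ᵖ⟧ Pb y X)) (tShape o) ⟩
  count (sat X (i , j) ∘ cellᶠ Pa Pb) (tShape o)
    ≡⟨ count-map _ _ (tShape o) ⟨
  count (sat X (i , j)) (map (cellᶠ Pa Pb) (tShape o)) ∎
  where open ≡-Reasoning

data Piece : Set where
  hstrip vstrip : Pos → Pos → Pos → ℕ → Piece
  tee           : Fin 4 → Pos → Pos → Piece

pieceTiles : ℕ → Piece → List Tile
pieceTiles X (hstrip Pa Pb Pe p) = map (shiftTile (⟦ Pa ⟧ X) (⟦ Pb ⟧ X)) (stripTiles p)
pieceTiles X (vstrip Pa Pb Pe p) = map transposeTile (map (shiftTile (⟦ Pb ⟧ X) (⟦ Pa ⟧ X)) (stripTiles p))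
pieceTiles X (tee o Pa Pb)       = tetT o (⟦ Pa ⟧ X) (⟦ Pb ⟧ X) ∷ []

pieceFormulas : Piece → List Formula
pieceFormulas (hstrip Pa Pb Pe p) = stripᶠ Pa Pb Pe ∷ []
pieceFormulas (vstrip Pa Pb Pe p) = transposeᶠ (stripᶠ Pb Pa Pe) ∷ []
pieceFormulas (tee o Pa Pb)       = map (cellᶠ Pa Pb) (tShape o)

PieceFits : ℕ → Piece → Set
PieceFits X (hstrip Pa Pb Pe p) = ⟦ Pb ⟧ X + p * 4 ≡ ⟦ Pe ⟧ X
PieceFits X (vstrip Pa Pb Pe p) = ⟦ Pa ⟧ X + p * 4 ≡ ⟦ Pe ⟧ X
PieceFits X (tee o Pa Pb)       = ⊤

piece-Describes : ∀ X pc → PieceFits X pc → Describes X (pieceFormulas pc) (pieceTiles X pc)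
piece-Describes X (hstrip Pa Pb Pe p) fits =
  IsTiling⇒Describes (pieceTiles X (hstrip Pa Pb Pe p)) (stripᶠ Pa Pb Pe) (sat-stripᶠ X Pa Pb Pe)
    (IsTiling-slantedStrip (⟦ Pa ⟧ X) (⟦ Pb ⟧ X) p fits)
piece-Describes X (vstrip Pa Pb Pe p) fits =
  IsTiling⇒Describes (pieceTiles X (vstrip Pa Pb Pe p)) (transposeᶠ (stripᶠ Pb Pa Pe))
    (λ (i , j) → trans (sat-stripᶠ X Pb Pa Pe (j , i)) (sym (evalF-transposeᶠ (holds X i) (holds X j) (stripᶠ Pb Pa Pe))))
    (IsTiling-transpose {ts = map (shiftTile (⟦ Pb ⟧ X) (⟦ Pa ⟧ X)) (stripTiles p)}
      (IsTiling-slantedStrip (⟦ Pb ⟧ X) (⟦ Pa ⟧ X) p fits))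
piece-Describes X (tee o Pa Pb) _ = tee-Describes X o Pa Pb

ringTiles : ℕ → List Piece → List Tile
ringTiles X = concatMap (pieceTiles X)

ringFormulas : List Piece → List Formula
ringFormulas = concatMap pieceFormulas

ring-Describes : ∀ X ps → All (PieceFits X) ps → Describes X (ringFormulas ps) (ringTiles X ps)
ring-Describes X []        []             c = refl
ring-Describes X (pc ∷ ps) (fits ∷ fitss) =
  Describes-++ {φs = pieceFormulas pc} {ts = pieceTiles X pc} (piece-Describes X pc fits) (ring-Describes X ps fitss)

-- A (suc c + X) translated by (s , s), except that coordinates below s are not excluded.
Aᶠ : ℕ → ℕ → Formula
Aᶠ s c = row (below (X+ (s + suc c))) ∧ᶠ col (below (X+ (s + suc c)))
       ∧ᶠ ¬ᶠ (row (at (# s)) ∧ᶠ col (at (# s)))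
       ∧ᶠ ¬ᶠ (row (at (# s)) ∧ᶠ col (at (# suc s)))
       ∧ᶠ ¬ᶠ (row (at (# suc s)) ∧ᶠ col (at (# s)))
       ∧ᶠ ¬ᶠ (row (at (# s)) ∧ᶠ col (at (X+ (s + c))))

coreᶠ : ℕ → Formula
coreᶠ c = ¬ᶠ row (below (# 2)) ∧ᶠ ¬ᶠ col (below (# 2)) ∧ᶠ Aᶠ 2 c

core-Describes : ∀ X c ts → IsTiling (A (suc c + X)) ts → Describes X (coreᶠ c ∷ []) (map (shiftTile 2 2) ts)
core-Describes X c ts tiles (0 , j)     = coverCount-shift-outside 2 2 ts 0 j (inj₁ (s≤s z≤n))
core-Describes X c ts tiles (1 , j)     = coverCount-shift-outside 2 2 ts 1 j (inj₁ (s≤s (s≤s z≤n)))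
core-Describes X c ts tiles (suc (suc i) , 0) = coverCount-shift-outside 2 2 ts (2 + i) 0 (inj₂ (s≤s z≤n))
core-Describes X c ts tiles (suc (suc i) , 1) = coverCount-shift-outside 2 2 ts (2 + i) 1 (inj₂ (s≤s (s≤s z≤n)))
core-Describes X c ts tiles (suc (suc i) , suc (suc j)) =
  trans (coverCount-shift 2 2 ts i j) (trans (tiles (i , j)) (sym (count-singleton (sat X (2 + i , 2 + j)) (coreᶠ c))))

open Breakpoints 8 12 using (agree; agree-sound)

grow : ℕ → List Piece → List Tile → List Tile
grow X ps ts = ringTiles X ps ++ map (shiftTile 2 2) ts

IsTiling-grow : ∀ X c c' ps ts → 8 ≤ X → All (PieceFits X) ps →
  T (agree (ringFormulas ps ++ coreᶠ c ∷ []) (Aᶠ 0 c' ∷ [])) →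
  IsTiling (A (suc c + X)) ts → IsTiling (A (suc c' + X)) (grow X ps ts)
IsTiling-grow X c c' ps ts 8≤X fits ok tiles cell = begin
  coverCount (grow X ps ts) cell
    ≡⟨ Describes-++ {φs = ringFormulas ps} {ts = ringTiles X ps}
                    (ring-Describes X ps fits) (core-Describes X c ts tiles) cell ⟩
  count (sat X cell) (ringFormulas ps ++ coreᶠ c ∷ [])
    ≡⟨ agree-sound (ringFormulas ps ++ coreᶠ c ∷ []) (Aᶠ 0 c' ∷ []) 8≤X ok cell ⟩
  count (sat X cell) (Aᶠ 0 c' ∷ [])
    ≡⟨ count-singleton (sat X cell) (Aᶠ 0 c') ⟩
  indicator (A (suc c' + X)) cell ∎
  where open ≡-Reasoning

insideSquare : ℕ → List Tile → Bool
insideSquare n = all (λ t → all (λ (x , y) → (x <ᵇ n) ∧ (y <ᵇ n)) (cells t))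

coverCorrectOnSquare : ℕ → Region → List Tile → Bool
coverCorrectOnSquare n R ts = all (λ i → all (λ j → coverCount ts (i , j) ≡ᵇ indicator R (i , j)) (upTo n)) (upTo n)

cellEq-outsideSquare : ∀ {n i j x y} → n ≤ i ⊎ n ≤ j → T ((x <ᵇ n) ∧ (y <ᵇ n)) → ¬ T (cellEq (i , j) (x , y))
cellEq-outsideSquare {n} {i} {j} {x} {y} outside inside hit
  with x<n , y<n ← Equivalence.to (T-∧ {x <ᵇ n}) inside
  with i≡x , j≡y ← Equivalence.to (T-∧ {i ≡ᵇ x}) hit
  with outside
... | inj₁ n≤i = ≤⇒≯ n≤i (subst (_< n) (sym (≡ᵇ⇒≡ i x i≡x)) (<ᵇ⇒< x n x<n))
... | inj₂ n≤j = ≤⇒≯ n≤j (subst (_< n) (sym (≡ᵇ⇒≡ j y j≡y)) (<ᵇ⇒< y n y<n))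

coverCount-outsideSquare : ∀ n ts i j → T (insideSquare n ts) → n ≤ i ⊎ n ≤ j → coverCount ts (i , j) ≡ 0
coverCount-outsideSquare n ts i j inside outside = uncovered (all⁺ _ ts inside)
  where
  uncovered : ∀ {ts} → All (λ t → T (all (λ (x , y) → (x <ᵇ n) ∧ (y <ᵇ n)) (cells t))) ts → coverCount ts (i , j) ≡ 0
  uncovered []                     = refl
  uncovered {t ∷ _} (inside-t ∷ inside-ts) =
    cong₂ _+_ (cong length (filter-none (T? ∘ cellEq (i , j))
                (All.map (cellEq-outsideSquare outside) (all⁺ _ (cells t) inside-t))))
              (uncovered inside-ts)

IsTiling-fromSquareCheck : ∀ n R ts → (∀ i j → n ≤ i ⊎ n ≤ j → R (i , j) ≡ false) →
  T (insideSquare n ts) → T (coverCorrectOnSquare n R ts) → IsTiling R ts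
IsTiling-fromSquareCheck n R ts R⊆square inside ok (i , j) with split n i | split n j
... | offset d | _ rewrite R⊆square (n + d) j (inj₁ (m≤m+n n d)) =
  coverCount-outsideSquare n ts (n + d) j inside (inj₁ (m≤m+n n d))
... | before i<n | offset d rewrite R⊆square i (n + d) (inj₂ (m≤m+n n d)) =
  coverCount-outsideSquare n ts i (n + d) inside (inj₂ (m≤m+n n d))
... | before i<n | before j<n =
  ≡ᵇ⇒≡ _ _ (lookup (all⁺ _ (upTo n) (lookup (all⁺ _ (upTo n) ok) (∈-upTo⁺ i<n))) (∈-upTo⁺ j<n))

A-outsideSquare : ∀ n i j → n ≤ i ⊎ n ≤ j → A n (i , j) ≡ false
A-outsideSquare n i j (inj₁ n≤i) rewrite ≤⇒<ᵇ-false n≤i = refl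
A-outsideSquare n i j (inj₂ n≤j) rewrite ≤⇒<ᵇ-false n≤j = ∧-zeroʳ _

count-map-invariant : ∀ {A : Set} (P : A → Bool) (f : A → A) → (∀ x → P (f x) ≡ P x) →
  ∀ xs → count P (map f xs) ≡ count P xs
count-map-invariant P f inv xs = trans (count-map P f xs) (count-cong inv xs)

isT-shiftTile : ∀ a b t → isT (shiftTile a b t) ≡ isT t
isT-shiftTile a b (tetT o x y) = refl
isT-shiftTile a b (mono x y)   = refl

isT-transposeTile : ∀ t → isT (transposeTile t) ≡ isT t
isT-transposeTile (tetT o x y) = refl
isT-transposeTile (mono x y)   = refl

numT-shift : ∀ a b ts → numT (map (shiftTile a b) ts) ≡ numT ts
numT-shift a b = count-map-invariant isT (shiftTile a b) (isT-shiftTile a b)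

numMono-shift : ∀ a b ts → numMono (map (shiftTile a b) ts) ≡ numMono ts
numMono-shift a b = count-map-invariant _ (shiftTile a b) (cong not ∘ isT-shiftTile a b)

numT-stripTiles : ∀ p → numT (stripTiles p) ≡ p * 2
numT-stripTiles zero    = refl
numT-stripTiles (suc p) = cong (2 +_) (trans (numT-shift 0 4 (stripTiles p)) (numT-stripTiles p))

numMono-stripTiles : ∀ p → numMono (stripTiles p) ≡ 0
numMono-stripTiles zero    = refl
numMono-stripTiles (suc p) = trans (numMono-shift 0 4 (stripTiles p)) (numMono-stripTiles p)

pieceTees : Piece → ℕ
pieceTees (hstrip _ _ _ p) = p * 2
pieceTees (vstrip _ _ _ p) = p * 2
pieceTees (tee _ _ _)      = 1

numT-pieceTiles : ∀ X pc → numT (pieceTiles X pc) ≡ pieceTees pc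
numT-pieceTiles X (hstrip Pa Pb Pe p) = trans (numT-shift (⟦ Pa ⟧ X) (⟦ Pb ⟧ X) (stripTiles p)) (numT-stripTiles p)
numT-pieceTiles X (vstrip Pa Pb Pe p) =
  trans (count-map-invariant isT transposeTile isT-transposeTile (pieceTiles X (hstrip Pb Pa Pe p)))
        (numT-pieceTiles X (hstrip Pb Pa Pe p))
numT-pieceTiles X (tee o Pa Pb)       = refl

numMono-pieceTiles : ∀ X pc → numMono (pieceTiles X pc) ≡ 0
numMono-pieceTiles X (hstrip Pa Pb Pe p) = trans (numMono-shift (⟦ Pa ⟧ X) (⟦ Pb ⟧ X) (stripTiles p)) (numMono-stripTiles p)
numMono-pieceTiles X (vstrip Pa Pb Pe p) =
  trans (count-map-invariant _ transposeTile (cong not ∘ isT-transposeTile) (pieceTiles X (hstrip Pb Pa Pe p)))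
        (numMono-pieceTiles X (hstrip Pb Pa Pe p))
numMono-pieceTiles X (tee o Pa Pb)       = refl

ringTees : List Piece → ℕ
ringTees ps = sum (map pieceTees ps)

numT-ringTiles : ∀ X ps → numT (ringTiles X ps) ≡ ringTees ps
numT-ringTiles X []        = refl
numT-ringTiles X (pc ∷ ps) =
  trans (count-++ isT (pieceTiles X pc) (ringTiles X ps)) (cong₂ _+_ (numT-pieceTiles X pc) (numT-ringTiles X ps))

numMono-ringTiles : ∀ X ps → numMono (ringTiles X ps) ≡ 0
numMono-ringTiles X []        = refl
numMono-ringTiles X (pc ∷ ps) =
  trans (count-++ _ (pieceTiles X pc) (ringTiles X ps)) (cong₂ _+_ (numMono-pieceTiles X pc) (numMono-ringTiles X ps))

numT-grow : ∀ X ps ts → numT (grow X ps ts) ≡ ringTees ps + numT ts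
numT-grow X ps ts =
  trans (count-++ isT (ringTiles X ps) _) (cong₂ _+_ (numT-ringTiles X ps) (numT-shift 2 2 ts))

numMono-grow : ∀ X ps ts → numMono (grow X ps ts) ≡ numMono ts
numMono-grow X ps ts =
  trans (count-++ _ (ringTiles X ps) _) (cong₂ _+_ (numMono-ringTiles X ps) (numMono-shift 2 2 ts))

teeCount : ℕ → ℕ
teeCount m = m * m + m ∸ 1

-- The two families of tilings

ring₃ : ℕ → List Piece
ring₃ q = hstrip (# 0) (# 2) (X+ 6) (suc q)
  ∷ vstrip (# 5) (X+ 5) (X+ 5) q
  ∷ hstrip (X+ 5) (# 2) (X+ 6) (suc q)
  ∷ vstrip (# 3) (# 0) (X+ 3) q
  ∷ tee (suc zero) (# 1) (# 0)
  ∷ tee zero (# 1) (# 2)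
  ∷ tee zero (X+ 3) (# 0)
  ∷ tee (suc (suc (suc zero))) (X+ 5) (# 0)
  ∷ tee (suc (suc zero)) (# 2) (X+ 4)
  ∷ tee (suc zero) (# 3) (X+ 5)
  ∷ []

tiling₃ : ℕ → List Tile
tiling₃ zero    = tetT (suc (suc (suc zero))) 1 0 ∷ mono 1 2 ∷ []
tiling₃ (suc q) = grow (q * 4) (ring₃ q) (tiling₃ q)

-- IsTiling-grow needs X ≥ 8, so the first three levels are checked cell by cell.
tiling₃-tiles : ∀ q → IsTiling (A (3 + q * 4)) (tiling₃ q)
tiling₃-tiles 0 = IsTiling-fromSquareCheck 3 (A 3) (tiling₃ 0) (A-outsideSquare 3) _ _
tiling₃-tiles 1 = IsTiling-fromSquareCheck 7 (A 7) (tiling₃ 1) (A-outsideSquare 7) _ _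
tiling₃-tiles 2 = IsTiling-fromSquareCheck 11 (A 11) (tiling₃ 2) (A-outsideSquare 11) _ _
tiling₃-tiles (suc (suc (suc q))) =
  IsTiling-grow ((2 + q) * 4) 2 6 (ring₃ (2 + q)) (tiling₃ (2 + q)) (m≤m+n 8 (q * 4))
    (refl ∷ refl ∷ refl ∷ refl ∷ _ ∷ _ ∷ _ ∷ _ ∷ _ ∷ _ ∷ []) _ (tiling₃-tiles (suc (suc q)))

numT-tiling₃ : ∀ q → numT (tiling₃ q) ≡ teeCount (1 + q * 2)
numT-tiling₃ zero    = refl
numT-tiling₃ (suc q) =
  trans (numT-grow (q * 4) (ring₃ q) (tiling₃ q)) (trans (cong (ringTees (ring₃ q) +_) (numT-tiling₃ q)) (step q))
  where
  -- ringTees (ring₃ q) + teeCount (1 + q * 2) ≡ teeCount (3 + q * 2), unfolded so that no ∸ is left.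
  step : ∀ q → (2 + q * 2 + (q * 2 + (2 + q * 2 + (q * 2 + 6)))) + (q * 2 + q * 2 * (1 + q * 2) + (1 + q * 2))
             ≡ 2 + q * 2 + (2 + q * 2) * (3 + q * 2) + (3 + q * 2)
  step = solve-∀

numMono-tiling₃ : ∀ q → numMono (tiling₃ q) ≡ 1
numMono-tiling₃ zero    = refl
numMono-tiling₃ (suc q) = trans (numMono-grow (q * 4) (ring₃ q) (tiling₃ q)) (numMono-tiling₃ q)

ring₅ : ℕ → List Piece
ring₅ q = hstrip (# 0) (# 3) (X+ 3) q
  ∷ vstrip (# 4) (X+ 7) (X+ 8) (suc q)
  ∷ hstrip (X+ 7) (# 3) (X+ 7) (suc q)
  ∷ vstrip (# 2) (# 0) (X+ 6) (suc q)
  ∷ tee zero (X+ 6) (# 0)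
  ∷ tee (suc (suc (suc zero))) (X+ 7) (# 1)
  ∷ tee (suc (suc zero)) (# 0) (X+ 3)
  ∷ tee (suc zero) (# 0) (X+ 5)
  ∷ tee zero (# 0) (X+ 7)
  ∷ tee (suc zero) (# 2) (X+ 7)
  ∷ tee (suc (suc (suc zero))) (# 0) (# 1)
  ∷ tee (suc (suc zero)) (# 2) (# 1)
  ∷ []

tiling₅ : ℕ → List Tile
tiling₅ zero    = tetT (suc zero) 0 1 ∷ tetT zero 0 3 ∷ tetT zero 2 0 ∷ mono 2 1
                ∷ tetT (suc zero) 2 3 ∷ tetT (suc (suc (suc zero))) 3 1 ∷ []
tiling₅ (suc q) = grow (q * 4) (ring₅ q) (tiling₅ q)

tiling₅-tiles : ∀ q → IsTiling (A (5 + q * 4)) (tiling₅ q)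
tiling₅-tiles 0 = IsTiling-fromSquareCheck 5 (A 5) (tiling₅ 0) (A-outsideSquare 5) _ _
tiling₅-tiles 1 = IsTiling-fromSquareCheck 9 (A 9) (tiling₅ 1) (A-outsideSquare 9) _ _
tiling₅-tiles 2 = IsTiling-fromSquareCheck 13 (A 13) (tiling₅ 2) (A-outsideSquare 13) _ _
tiling₅-tiles (suc (suc (suc q))) =
  IsTiling-grow ((2 + q) * 4) 4 8 (ring₅ (2 + q)) (tiling₅ (2 + q)) (m≤m+n 8 (q * 4))
    (refl ∷ refl ∷ refl ∷ refl ∷ _ ∷ _ ∷ _ ∷ _ ∷ _ ∷ _ ∷ _ ∷ _ ∷ []) _ (tiling₅-tiles (suc (suc q)))

numT-tiling₅ : ∀ q → numT (tiling₅ q) ≡ teeCount (2 + q * 2)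
numT-tiling₅ zero    = refl
numT-tiling₅ (suc q) =
  trans (numT-grow (q * 4) (ring₅ q) (tiling₅ q)) (trans (cong (ringTees (ring₅ q) +_) (numT-tiling₅ q)) (step q))
  where
  step : ∀ q → (q * 2 + (2 + q * 2 + (2 + q * 2 + (2 + q * 2 + 8)))) + (1 + q * 2 + (1 + q * 2) * (2 + q * 2) + (2 + q * 2))
             ≡ 3 + q * 2 + (3 + q * 2) * (4 + q * 2) + (4 + q * 2)
  step = solve-∀

numMono-tiling₅ : ∀ q → numMono (tiling₅ q) ≡ 1
numMono-tiling₅ zero    = refl
numMono-tiling₅ (suc q) = trans (numMono-grow (q * 4) (ring₅ q) (tiling₅ q)) (numMono-tiling₅ q)

data Parity : ℕ → Set where
  even : ∀ q → Parity (q * 2)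
  odd  : ∀ q → Parity (suc (q * 2))

parity : ∀ k → Parity k
parity zero = even 0
parity (suc k) with parity k
... | even q = odd q
... | odd q  = even (suc q)

lemma1 : (m : ℕ) → 1 ≤ m →
    Σ (List Tile) (λ ts →
      IsTiling (A (2 * m + 1)) ts × numT ts ≡ m * m + m ∸ 1 × numMono ts ≡ 1)
lemma1 (suc k) _ with parity k
... | even q = tiling₃ q , subst (λ n → IsTiling (A n) (tiling₃ q)) (side q) (tiling₃-tiles q)
             , numT-tiling₃ q , numMono-tiling₃ q
  where
  side : ∀ q → 3 + q * 4 ≡ 2 * (1 + q * 2) + 1
  side = solve-∀
... | odd q  = tiling₅ q , subst (λ n → IsTiling (A n) (tiling₅ q)) (side q) (tiling₅-tiles q)
             , numT-tiling₅ q , numMono-tiling₅ q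
  where
  side : ∀ q → 5 + q * 4 ≡ 2 * (2 + q * 2) + 1
  side = solve-∀
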